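{- Let $\ell$ be a prime, $G$ a finite abelian group and $S\subseteq G$ with $S$ generating $G$, $S=S^{ -1}$, $1\notin S$. Let $X=\mathrm{Cay}(G,S)$, let $\beta:S\to\mathbb{Z}_\ell$ satisfy conditions (1)–(4) below and let $\alpha=\alpha_\beta$. Then for every $k\ge0$ the derived graph $X(\mathbb{Z}/\ell^k\mathbb{Z},\alpha_{/k})$ is connected.
   Context: $\mathrm{Cay}(G,S)$ has vertices $\{v_g:g\in G\}$ and a directed edge $e(g_1,g_2)$ from $v_{g_1}$ to $v_{g_2}$ whenever $g_1g_2^{ -1}\in S$, with inverse edge $e(g_2,g_1)$. Conditions on $\beta$: (1) its image generates $\mathbb{Z}_\ell$ as a $\mathbb{Z}_\ell$-module; (2) $\beta(s^{ -1})=-\beta(s)$; (3) $\beta(S)\subseteq\mathbb{Z}$; (4) there exist $m>0$ and $(h_1,\dots,h_m)\in S^m$ with $h_1\cdots h_m\in S$ and $\beta(h_1\cdots h_m)\not\equiv\sum_i\beta(h_i)\pmod\ell$. The voltage assignment is $\alpha(e(g_1,g_2))=\beta(g_1g_2^{ -1})\in\mathbb{Z}_\ell$ (so $\alpha$ of the inverse edge is $-\alpha(e)$), and $\alpha_{/k}$ is its reduction modulo $\ell^k$. The derived graph $X(\mathbb{Z}/\ell^k\mathbb{Z},\alpha_{/k})$ has vertex set $\{v_g\}\times\mathbb{Z}/\ell^k\mathbb{Z}$ and directed edge set $E_X^+\times\mathbb{Z}/\ell^k\mathbb{Z}$, where $(e,\sigma)$ goes from $(o(e),\sigma)$ to $(t(e),\sigma+\alpha_{/k}(e))$,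 $o(e),t(e)$ being the source and target of $e$, and the inverse of $(e,\sigma)$ is $(\bar e,\sigma+\alpha_{/k}(e))$ with $\bar e$ the inverse of $e$. -}

module Defs where

open import Level using (Level; _⊔_)
open import Algebra.Bundles using (AbelianGroup)
open import Data.Nat using (ℕ; _^_; _>_)
open import Data.Integer using (ℤ; +_; _+_; _-_; -_)
open import Data.Integer.Divisibility using (_∣_)
open import Data.Fin using (Fin)
open import Data.List using (List; foldr; length; map)
open import Data.List.Relation.Unary.All using (All)
open import Data.Product using (Σ; ∃; _×_; _,_)
open import Data.Sum using (_⊎_)
open import Relation.Nullary using (¬_)
open import Relation.Unary using (Pred)
open import Relation.Binary.PropositionalEquality as ≡ using (_≡_)
open import Relation.Binary.Construct.Closure.ReflexiveTransitive using (Star)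
open import Function.Bundles using (Inverse)

_≡_[mod_] : ℤ → ℤ → ℕ → Set
a ≡ b [mod n ] = (+ n) ∣ (a - b)

-- Everything about the Cayley graph Cay(G,S) with the voltage assignment
-- alpha(e(g1,g2)) = beta(g1 g2^{-1}).  beta is given as a function on all of G
-- (only its values on S matter); integer-valued by condition (3).
module CayleyDerived {c r p : Level} (G : AbelianGroup c r)
                     (S : Pred (AbelianGroup.Carrier G) p)
                     (β : AbelianGroup.Carrier G → ℤ) where
  open AbelianGroup G using (Carrier; _≈_; _∙_; ε; _⁻¹; setoid)

  prod : List Carrier → Carrier
  prod = foldr _∙_ ε

  IsFinite : Set (c ⊔ r)
  IsFinite = ∃ λ n → Inverse setoid (≡.setoid (Fin n))

  SubsetWellDefined : Set (c ⊔ r ⊔ p)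
  SubsetWellDefined = ∀ {x y} → x ≈ y → S x → S y

  BetaWellDefined : Set (c ⊔ r ⊔ p)
  BetaWellDefined = ∀ {x y} → S x → x ≈ y → β x ≡ β y

  Generates : Set (c ⊔ r ⊔ p)
  Generates = ∀ g → ∃ λ (xs : List Carrier) →
                All (λ x → S x ⊎ S (x ⁻¹)) xs × (g ≈ prod xs)

  SymmetricSet : Set (c ⊔ p)
  SymmetricSet = ∀ s → S s → S (s ⁻¹)

  NoIdentity : Set (c ⊔ r ⊔ p)
  NoIdentity = ∀ s → S s → ¬ (s ≈ ε)

  -- condition (1): the image of beta generates Z_ℓ as a Z_ℓ-module
  -- (for a finite set of integers: some value is an ℓ-adic unit, i.e. not divisible by ℓ)
  Cond1 : ℕ → Set (c ⊔ p)
  Cond1 ℓ = ∃ λ s → S s × ¬ ((+ ℓ) ∣ β s)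

  Cond2 : Set (c ⊔ p)
  Cond2 = ∀ s → S s → β (s ⁻¹) ≡ - β s

  Cond4 : ℕ → Set (c ⊔ p)
  Cond4 ℓ = ∃ λ (hs : List Carrier) → (length hs > 0) × All S hs × S (prod hs)
              × ¬ (β (prod hs) ≡ foldr _+_ (+ 0) (map β hs) [mod ℓ ])

  -- Vertices (v_g, σ) are
  -- represented by pairs (g , σ) ∈ G × ℤ, taken up to g ≈ g' and σ ≡ σ' mod ℓ^k
  -- (constructor 'same'); 'edge' is the edge (e(g1,g2), σ) from (g1, σ) to
  -- (g2, σ + beta(g1 g2⁻¹)), present whenever g1 g2⁻¹ ∈ S.
  data DerivedStep (ℓ k : ℕ) : Carrier × ℤ → Carrier × ℤ → Set (c ⊔ r ⊔ p) where
    edge : ∀ {g₁ g₂ σ τ} → S (g₁ ∙ g₂ ⁻¹) →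
           τ ≡ σ + β (g₁ ∙ g₂ ⁻¹) [mod ℓ ^ k ] → DerivedStep ℓ k (g₁ , σ) (g₂ , τ)
    same : ∀ {g₁ g₂ σ τ} → g₁ ≈ g₂ → τ ≡ σ [mod ℓ ^ k ] → DerivedStep ℓ k (g₁ , σ) (g₂ , τ)

  -- connectedness: any vertex reaches any other along edges of the derived graph
  -- (the edge set is closed under inverses, so this is the usual connectedness)
  DerivedConnected : ℕ → ℕ → Set (c ⊔ r ⊔ p)
  DerivedConnected ℓ k = ∀ u v → Star (DerivedStep ℓ k) u v

-- A walk in the Cayley graph along s₁ , … , sₘ ∈ S lifts to a walk in the
-- derived graph from (g , σ) to (g (s₁ ⋯ sₘ)⁻¹ , σ + β s₁ + ⋯ + β sₘ).  As S
-- generates G, it therefore suffices to join (g , σ) to (g , σ + 1).  By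
-- conditions (2) and (4) the closed walk (h₁ ⋯ hₘ)⁻¹ , h₁ , … , hₘ has voltage
-- D = Σ β hᵢ − β (h₁ ⋯ hₘ) prime to ℓ; going around it t times adds t D to σ,
-- and t D ≡ 1 mod ℓ^k for a Bézout coefficient t.
module Submission where

open import Defs
open import Level using (Level)
open import Algebra.Bundles using (AbelianGroup; Group)
open import Data.Nat using (ℕ)
open import Data.Nat.Primality using (Prime)
open import Data.Integer using (ℤ)
open import Relation.Unary using (Pred)

import Data.Nat as ℕ
import Data.Nat.Properties as ℕ
import Data.Nat.Divisibility as ℕ
open import Data.Nat.Coprimality as Coprime using (Coprime; coprime-Bézout; coprime-divisor)
open import Data.Nat.GCD using (module Bézout)
open import Data.Nat.Primality using (prime⇒irreducible; prime⇒nonZero)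
open import Data.Integer using (+_; _+_; _*_; -_; _-_; ∣_∣; 1ℤ; -1ℤ)
open import Data.Integer.Properties
  using (+-identityʳ; +-assoc; *-zeroˡ; suc-*; -1*i≡-i; ∣-i∣≡∣i∣; +∣i∣≡i⊎+∣i∣≡-i; pos-*)
open import Data.Integer.DivMod using (_%ℕ_; _/ℕ_; a≡a%ℕn+[a/ℕn]*n)
open import Data.Integer.Divisibility using (_∣_)
import Data.Integer.Divisibility.Signed as Signed
open import Data.Integer.Tactic.RingSolver using (solve-∀)
open import Data.Product using (∃; _×_; _,_)
open import Data.Sum using (_⊎_; inj₁; inj₂)
open import Data.List using (List; []; _∷_; foldr; map)
open import Data.List.Relation.Unary.All as All using (All; []; _∷_)
open import Data.Empty using (⊥-elim)
open import Relation.Nullary using (¬_)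
open import Relation.Binary.PropositionalEquality
  using (_≡_; refl; sym; trans; cong; subst; module ≡-Reasoning)
import Relation.Binary.Construct.Closure.ReflexiveTransitive as Star
open Star using (Star; _◅_; _◅◅_)

module _ {n : ℕ} where

  ≡⇒≡-mod : ∀ {a b} → a ≡ b → a ≡ b [mod n ]
  ≡⇒≡-mod {a} refl = Signed.∣⇒∣ᵤ {+ n} (Signed.divides (+ 0) (a-a≡0*n a))
    where
    a-a≡0*n : ∀ a → a - a ≡ + 0 * + n
    a-a≡0*n = solve-∀

  +-congˡ-mod : ∀ c {a b} → a ≡ b [mod n ] → (c + a) ≡ (c + b) [mod n ]
  +-congˡ-mod c {a} {b} = subst (λ z → + n ∣ z) (cancel c a b)
    where
    cancel : ∀ c a b → a - b ≡ (c + a) - (c + b)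
    cancel = solve-∀

  *-congʳ-mod : ∀ c {a b} → a ≡ b [mod n ] → (a * c) ≡ (b * c) [mod n ]
  *-congʳ-mod c {a} {b} n∣a-b =
    subst (λ z → + n ∣ z) (distrib a b c)
      (Signed.∣⇒∣ᵤ {+ n} (Signed.∣m⇒∣m*n {+ n} {a - b} c (Signed.∣ᵤ⇒∣ n∣a-b)))
    where
    distrib : ∀ a b c → (a - b) * c ≡ a * c - b * c
    distrib = solve-∀

  ≡-%ℕ-mod : ∀ a .{{_ : ℕ.NonZero n}} → a ≡ + (a %ℕ n) [mod n ]
  ≡-%ℕ-mod a = Signed.∣⇒∣ᵤ {+ n} (Signed.divides (a /ℕ n) (begin
    a - + (a %ℕ n)                             ≡⟨ cong (_- + (a %ℕ n)) (a≡a%ℕn+[a/ℕn]*n a n) ⟩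
    (+ (a %ℕ n) + (a /ℕ n) * + n) - + (a %ℕ n) ≡⟨ cancel (+ (a %ℕ n)) (a /ℕ n * + n) ⟩
    (a /ℕ n) * + n                             ∎))
    where
    open ≡-Reasoning
    cancel : ∀ r q → (r + q) - r ≡ q
    cancel = solve-∀

  coprime⇒invertible-mod : ∀ {m} → Coprime m n → ∃ λ t → 1ℤ ≡ (t * + m) [mod n ]
  coprime⇒invertible-mod {m} m⊥n with coprime-Bézout m⊥n
  ... | Bézout.+- x y 1+yn≡xm = + x , Signed.∣⇒∣ᵤ {+ n} (Signed.divides (- + y) (begin
    1ℤ - + x * + m            ≡⟨ cong (λ z → 1ℤ - z) (pos-* x m) ⟨
    1ℤ - + (x ℕ.* m)          ≡⟨ cong (λ z → 1ℤ - + z) 1+yn≡xm ⟨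
    1ℤ - (1ℤ + + (y ℕ.* n))   ≡⟨ cong (λ z → 1ℤ - (1ℤ + z)) (pos-* y n) ⟩
    1ℤ - (1ℤ + + y * + n)     ≡⟨ cancel (+ y) (+ n) ⟩
    - + y * + n               ∎))
    where
    open ≡-Reasoning
    cancel : ∀ y n → 1ℤ - (1ℤ + y * n) ≡ - y * n
    cancel = solve-∀
  ... | Bézout.-+ x y 1+xm≡yn = - + x , Signed.∣⇒∣ᵤ {+ n} (Signed.divides (+ y) (begin
    1ℤ - (- + x) * + m        ≡⟨ cancel (+ x) (+ m) ⟩
    1ℤ + + x * + m            ≡⟨ cong (λ z → 1ℤ + z) (pos-* x m) ⟨
    + (1 ℕ.+ x ℕ.* m)         ≡⟨ cong +_ 1+xm≡yn ⟩
    + (y ℕ.* n)               ≡⟨ pos-* y n ⟩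
    + y * + n                 ∎))
    where
    open ≡-Reasoning
    cancel : ∀ x m → 1ℤ - (- x) * m ≡ 1ℤ + x * m
    cancel = solve-∀

∣-a+b∣≡∣a-b∣ : ∀ a b → ∣ - a + b ∣ ≡ ∣ a - b ∣
∣-a+b∣≡∣a-b∣ a b = trans (sym (∣-i∣≡∣i∣ (- a + b))) (cong ∣_∣ (negate a b))
  where
  negate : ∀ a b → - (- a + b) ≡ a - b
  negate = solve-∀

coprime-*ʳ : ∀ {m a b} → Coprime m a → Coprime m b → Coprime m (a ℕ.* b)
coprime-*ʳ {a = a} m⊥a m⊥b {d} (d∣m , d∣ab) = m⊥b (d∣m , coprime-divisor d⊥a d∣ab)
  where
  d⊥a : Coprime d a
  d⊥a (e∣d , e∣a) = m⊥a (ℕ.∣-trans e∣d d∣m , e∣a)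

coprime-^ʳ : ∀ {m p} → Coprime m p → ∀ k → Coprime m (p ℕ.^ k)
coprime-^ʳ m⊥p ℕ.zero    = Coprime.sym (Coprime.1-coprimeTo _)
coprime-^ʳ m⊥p (ℕ.suc k) = coprime-*ʳ m⊥p (coprime-^ʳ m⊥p k)

∤-prime⇒coprime : ∀ {p m} → Prime p → ¬ p ℕ.∣ m → Coprime m p
∤-prime⇒coprime {p} {m} p-prime p∤m (d∣m , d∣p) with prime⇒irreducible p-prime d∣p
... | inj₁ d≡1 = d≡1
... | inj₂ d≡p = ⊥-elim (p∤m (subst (ℕ._∣ m) d≡p d∣m))

module DerivedWalks {c r p : Level} (G : AbelianGroup c r)
  (S : Pred (AbelianGroup.Carrier G) p) (β : AbelianGroup.Carrier G → ℤ)
  (S-wd : CayleyDerived.SubsetWellDefined G S β)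
  (β-wd : CayleyDerived.BetaWellDefined G S β)
  (ℓ k : ℕ) .{{_ : ℕ.NonZero ℓ}} where

  open AbelianGroup G using (Carrier; _≈_; _⁻¹; ε; group; assoc; inverseʳ; inverseˡ)
    renaming (refl to ≈-refl; sym to ≈-sym; trans to ≈-trans)
  open Group group using (_//_; _\\_)
  open import Algebra.Properties.Group group
    using (x∙y⁻¹≈ε⇒x≈y; ⁻¹-involutive; \\-leftDividesˡ; x≈z//y; y≈x\\z)
  open CayleyDerived G S β

  private instance
    ℓ^k≢0 : ℕ.NonZero (ℓ ℕ.^ k)
    ℓ^k≢0 = ℕ.m^n≢0 ℓ k

  infix 4 _⟶*_
  _⟶*_ : Carrier × ℤ → Carrier × ℤ → Set _
  _⟶*_ = Star (DerivedStep ℓ k)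

  voltage : List Carrier → ℤ
  voltage xs = foldr _+_ (+ 0) (map β xs)

  lift-edge : ∀ {g g' s σ} → S s → g // g' ≈ s → (g , σ) ⟶* (g' , σ + β s)
  lift-edge {σ = σ} Ss g//g'≈s =
    edge (S-wd (≈-sym g//g'≈s) Ss) (≡⇒≡-mod (cong (λ z → σ + z) (β-wd Ss (≈-sym g//g'≈s)))) ◅ Star.ε

  lift-walk : ∀ {xs g g' σ} → All S xs → g // g' ≈ prod xs → (g , σ) ⟶* (g' , σ + voltage xs)
  lift-walk {[]} {g} {g'} {σ} [] g//g'≈ε =
    same (x∙y⁻¹≈ε⇒x≈y g g' g//g'≈ε) (≡⇒≡-mod (+-identityʳ σ)) ◅ Star.ε
  lift-walk {x ∷ xs} {g} {g'} {σ} (Sx ∷ Sxs) g//g'≈x∙∏xs =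
    lift-edge Sx (≈-sym (x≈z//y x (x \\ g) g (\\-leftDividesˡ x g)))
    ◅◅ lift-walk Sxs [x\\g]//g'≈∏xs
    ◅◅ same ≈-refl (≡⇒≡-mod (sym (+-assoc σ (β x) (voltage xs)))) ◅ Star.ε
    where
    [x\\g]//g'≈∏xs : (x \\ g) // g' ≈ prod xs
    [x\\g]//g'≈∏xs =
      ≈-trans (assoc (x ⁻¹) g (g' ⁻¹)) (≈-sym (y≈x\\z x (prod xs) (g // g') (≈-sym g//g'≈x∙∏xs)))

  Shift : ℤ → Set _
  Shift a = ∀ g σ → (g , σ) ⟶* (g , σ + a)

  shift-0 : Shift (+ 0)
  shift-0 g σ = same ≈-refl (≡⇒≡-mod (+-identityʳ σ)) ◅ Star.ε

  shift-+ : ∀ {a b} → Shift a → Shift b → Shift (a + b)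
  shift-+ {a} {b} shift-a shift-b g σ =
    shift-a g σ ◅◅ shift-b g (σ + a) ◅◅ same ≈-refl (≡⇒≡-mod (sym (+-assoc σ a b))) ◅ Star.ε

  shift-resp-mod : ∀ {a b} → Shift a → b ≡ a [mod ℓ ℕ.^ k ] → Shift b
  shift-resp-mod shift-a b≡a g σ =
    shift-a g σ ◅◅ same ≈-refl (+-congˡ-mod σ b≡a) ◅ Star.ε

  shift-ℕ* : ∀ {a} → Shift a → ∀ m → Shift (+ m * a)
  shift-ℕ* {a} shift-a ℕ.zero    = subst Shift (sym (*-zeroˡ a)) shift-0
  shift-ℕ* {a} shift-a (ℕ.suc m) =
    subst Shift (sym (suc-* (+ m) a)) (shift-+ shift-a (shift-ℕ* shift-a m))

  shift-* : ∀ {a} → Shift a → ∀ t → Shift (t * a)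
  shift-* {a} shift-a t =
    shift-resp-mod (shift-ℕ* shift-a (t %ℕ ℓ ℕ.^ k)) (*-congʳ-mod a {t} (≡-%ℕ-mod t))

  shift-∣∣ : ∀ {a} → Shift a → Shift (+ ∣ a ∣)
  shift-∣∣ {a} shift-a with +∣i∣≡i⊎+∣i∣≡-i a
  ... | inj₁ ∣a∣≡a  = subst Shift (sym ∣a∣≡a) shift-a
  ... | inj₂ ∣a∣≡-a = subst Shift (trans (-1*i≡-i a) (sym ∣a∣≡-a)) (shift-* shift-a -1ℤ)

  closed-walk-shift : ∀ {xs} → All S xs → prod xs ≈ ε → Shift (voltage xs)
  closed-walk-shift Sxs ∏xs≈ε g σ = lift-walk Sxs (≈-trans (inverseʳ g) (≈-sym ∏xs≈ε))

  unit-shift⇒fibre-connected : Prime ℓ → ∀ {a} → Shift a → ¬ ℓ ℕ.∣ ∣ a ∣ →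
                               ∀ g σ τ → (g , σ) ⟶* (g , τ)
  unit-shift⇒fibre-connected ℓ-prime {a} shift-a ℓ∤a g σ τ
    with coprime⇒invertible-mod (coprime-^ʳ (∤-prime⇒coprime ℓ-prime ℓ∤a) k)
  ... | t , 1≡t∣a∣ =
    shift-* shift-1 (τ - σ) g σ ◅◅ same ≈-refl (≡⇒≡-mod (cancel σ τ)) ◅ Star.ε
    where
    shift-1 : Shift 1ℤ
    shift-1 = shift-resp-mod (shift-* (shift-∣∣ shift-a) t) 1≡t∣a∣
    cancel : ∀ σ τ → τ ≡ σ + (τ - σ) * 1ℤ
    cancel = solve-∀

  fibre-connected⇒connected : Generates → SymmetricSet →
                              (∀ g σ τ → (g , σ) ⟶* (g , τ)) → DerivedConnected ℓ k
  fibre-connected⇒connected S-gen S-sym fibre-connected (g , σ) (g' , τ)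
    with S-gen (g // g')
  ... | xs , S±xs , g//g'≈∏xs =
    lift-walk (All.map S±⇒S S±xs) g//g'≈∏xs ◅◅ fibre-connected g' (σ + voltage xs) τ
    where
    S±⇒S : ∀ {x} → S x ⊎ S (x ⁻¹) → S x
    S±⇒S (inj₁ Sx)   = Sx
    S±⇒S (inj₂ Sx⁻¹) = S-wd (⁻¹-involutive _) (S-sym _ Sx⁻¹)

proposition4p3 : {c r p : Level} (ℓ : ℕ) → Prime ℓ →
    (G : AbelianGroup c r) → (S : Pred (AbelianGroup.Carrier G) p) →
    (β : AbelianGroup.Carrier G → ℤ) →
    CayleyDerived.IsFinite G S β →
    CayleyDerived.SubsetWellDefined G S β →
    CayleyDerived.BetaWellDefined G S β →
    CayleyDerived.Generates G S β →
    CayleyDerived.SymmetricSet G S β →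
    CayleyDerived.NoIdentity G S β →
    CayleyDerived.Cond1 G S β ℓ →
    CayleyDerived.Cond2 G S β →
    CayleyDerived.Cond4 G S β ℓ →
    (k : ℕ) → CayleyDerived.DerivedConnected G S β ℓ k
proposition4p3 ℓ ℓ-prime G S β _ S-wd β-wd S-gen S-sym _ _ cond2 (hs , _ , Shs , Sh , βh≢voltage) k =
  fibre-connected⇒connected S-gen S-sym
    (unit-shift⇒fibre-connected ℓ-prime loop-shift loop-voltage-unit)
  where
  open AbelianGroup G using (Carrier; _⁻¹; inverseˡ)
  open CayleyDerived G S β using (prod)
  open DerivedWalks G S β S-wd β-wd ℓ k {{prime⇒nonZero ℓ-prime}}

  h : Carrier
  h = prod hs

  loop-shift : Shift (β (h ⁻¹) + voltage hs)
  loop-shift = closed-walk-shift (S-sym h Sh ∷ Shs) (inverseˡ h)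

  loop-voltage-unit : ¬ ℓ ℕ.∣ ∣ β (h ⁻¹) + voltage hs ∣
  loop-voltage-unit rewrite cond2 h Sh | ∣-a+b∣≡∣a-b∣ (β h) (voltage hs) = βh≢voltage
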